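{- For every $n\ge1$ and every $0\le k<n$, the number of involutions $\pi$ of $\{1,\dots,n\}$ that avoid the pattern $321$ and have exactly $k$ descents is $\binom{\lceil n/2\rceil}{k}\binom{\lfloor n/2\rfloor}{k}$.
   Context: A permutation $\pi$ of $\{1,\dots,n\}$ is an involution if $\pi=\pi^{ -1}$; it avoids $321$ if there are no $i<j<k$ with $\pi(i)>\pi(j)>\pi(k)$. A descent of $\pi$ is an index $1\le i<n$ with $\pi(i)>\pi(i+1)$. -}

module Defs where

open import Data.Nat using (ℕ; zero; suc; _+_)
open import Data.Fin using (Fin; inject₁) renaming (suc to fsuc)
import Data.Fin as F
open import Data.Product using (_×_; Σ)
open import Data.List using (List; length)
open import Data.List.Relation.Unary.All using (All)
open import Data.List.Relation.Unary.Any using (Any)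
open import Data.List.Relation.Unary.AllPairs using (AllPairs)
open import Relation.Binary.PropositionalEquality using (_≡_)
open import Relation.Nullary using (¬_; Dec; yes; no)

-- A permutation of {1,…,n} is represented (0-indexed) as a function
-- π : Fin n → Fin n.  π is an involution iff π ∘ π = id; this already
-- forces π to be a bijection with π = π⁻¹.
IsInvolution : ∀ {n} → (Fin n → Fin n) → Set
IsInvolution π = ∀ i → π (π i) ≡ i

Avoids321 : ∀ {n} → (Fin n → Fin n) → Set
Avoids321 {n} π = ∀ (i j k : Fin n) → i F.< j → j F.< k →
  ¬ ((π j F.< π i) × (π k F.< π j))

descents′ : ∀ {m n} → (Fin (suc m) → Fin n) → ℕ
descents′ {zero}  a = 0
descents′ {suc m} {n} a with a (fsuc F.zero) F.<? a F.zero
... | yes _ = suc (descents′ {m} (λ i → a (fsuc i)))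
... | no  _ = descents′ {m} (λ i → a (fsuc i))

des : ∀ {n} → (Fin n → Fin n) → ℕ
des {zero}  π = 0
des {suc n} π = descents′ π

_≗ₚ_ : ∀ {n} → (Fin n → Fin n) → (Fin n → Fin n) → Set
π ≗ₚ σ = ∀ i → π i ≡ σ i

Counted : ∀ {n} → ℕ → (Fin n → Fin n) → Set
Counted k π = IsInvolution π × Avoids321 π × des π ≡ k

-- "The number of maps π : Fin n → Fin n satisfying P is m":
-- there is a list of exactly m pairwise distinct (as maps) such π, and every
-- π satisfying P equals (pointwise) some element of the list.
HasCount : ∀ n → ((Fin n → Fin n) → Set) → ℕ → Set
HasCount n P m = Σ (List (Fin n → Fin n)) λ L →
  length L ≡ m
  × AllPairs (λ π σ → ¬ (π ≗ₚ σ)) L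
  × All P L
  × (∀ π → P π → Any (π ≗ₚ_) L)

-- A 321-avoiding involution π of {0,…,n−1} is encoded by the word whose
-- j-th step is U if j < π j (j opens an arc), D if π j < j (j closes an
-- arc) and F if π j = j.  Avoiding 321 means that the arcs do not nest and
-- cover no fixed point; this makes the word a path that never goes below
-- height 0 and has flat steps only at height 0.  Conversely every such path
-- decodes to such an involution by matching its r-th U with its r-th D, and
-- encoding and decoding are inverse.  Descents of π are exactly the peaks
-- U D of its path.
module Submission where

open import Defs

open import Data.Bool using (Bool; true; false; _∧_; not)
open import Data.Bool.Properties using (∧-zeroʳ; ∧-identityʳ; T-≡; ⇔→≡)
open import Data.Empty using (⊥; ⊥-elim)
open import Data.Fin using (Fin; toℕ; fromℕ<) renaming (suc to fsuc)
import Data.Fin as Fin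
open import Data.Fin.Properties using (toℕ-injective; toℕ<n; fromℕ<-toℕ; toℕ-fromℕ<)
open import Data.List using (List; []; _∷_; length; map; _++_; [_]; applyUpTo)
open import Data.List.Properties
  using (length-map; length-++; length-applyUpTo; ∷-injectiveˡ; ∷-injectiveʳ)
open import Data.List.Membership.Propositional using (_∈_)
open import Data.List.Relation.Unary.All using (All; []; _∷_)
import Data.List.Relation.Unary.All as All
import Data.List.Relation.Unary.All.Properties as AllP
open import Data.List.Relation.Unary.AllPairs using (AllPairs; []; _∷_)
import Data.List.Relation.Unary.AllPairs as AP
import Data.List.Relation.Unary.AllPairs.Properties as APP
open import Data.List.Relation.Unary.Any using (Any; here; there)
import Data.List.Relation.Unary.Any as Any
import Data.List.Relation.Unary.Any.Properties as AnyP
open import Data.Nat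
open import Data.Nat.Combinatorics using (_C_; nCk+nC[k+1]≡[n+1]C[k+1])
open import Data.Nat.Induction using (<-rec)
open import Data.Nat.Properties
open import Data.Product using (_×_; _,_; proj₁; proj₂)
open import Function using (_∘_)
open import Function.Bundles using (Equivalence; mk⇔)
open import Relation.Binary.Definitions using (Tri; tri<; tri≈; tri>)
open import Relation.Binary.PropositionalEquality hiding ([_])
open import Relation.Nullary using (¬_; contradiction; yes; no)

data Step : Set where
  U D F : Step

data Path : ℕ → List Step → Set where
  done : Path 0 []
  flat : ∀ {w} → Path 0 w → Path 0 (F ∷ w)
  up   : ∀ {h w} → Path (suc h) w → Path h (U ∷ w)
  down : ∀ {h w} → Path h w → Path (suc h) (D ∷ w)

bit : Bool → ℕ
bit true  = 1
bit false = 0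

-- `peaks afterUp w` is the number of factors U D in w, where a leading D
-- also counts as a peak if the step before w was an up step (afterUp).
peaks : Bool → List Step → ℕ
peaks afterUp []      = 0
peaks afterUp (U ∷ w) = peaks true w
peaks afterUp (D ∷ w) = bit afterUp + peaks false w
peaks afterUp (F ∷ w) = peaks false w

ups downs flats : List (List Step) → List (List Step)
ups   = map (U ∷_)
downs = map (D ∷_)
flats = map (F ∷_)

-- `paths m h k afterUp` lists the paths from height h with h + m steps and
-- k peaks, by recursion on the first step.  Since every path has at least
-- h steps, m counts the "free" steps; an up step from height h forces two
-- more free steps (its own and the matching down step).
paths      : ℕ → ℕ → ℕ → Bool → List (List Step)
downPaths  : ℕ → ℕ → ℕ → Bool → List (List Step)
afterDown  : ℕ → ℕ → ℕ → Bool → List (List Step)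
paths zero          zero    zero    _ = [ [] ]
paths zero          zero    (suc k) _ = []
paths (suc zero)    zero    k       _ = flats (paths 0 0 k false)
paths (suc (suc m)) zero    k       _ =
  flats (paths (suc m) 0 k false) ++ ups (paths m 1 k true)
paths zero          (suc h) k u = downPaths zero h k u
paths (suc zero)    (suc h) k u = downPaths (suc zero) h k u
paths (suc (suc m)) (suc h) k u =
  ups (paths m (suc (suc h)) k true) ++ downPaths (suc (suc m)) h k u
downPaths m h k u = downs (afterDown m h k u)
afterDown m h k       false = paths m h k false
afterDown m h zero    true  = []
afterDown m h (suc k) true  = paths m h k false

length-paths : ∀ m h k →
  length (paths m h k false) ≡ ((h + ⌈ m /2⌉) C k) * (⌊ m /2⌋ C k)
length-paths-afterUp : ∀ m h k →
  length (paths m (suc h) (suc k) true) ≡ (suc ⌊ m /2⌋ C suc k) * ((h + ⌈ m /2⌉) C k)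
length-paths-afterUp-zero : ∀ m h → length (paths m (suc h) 0 true) ≡ 0

pascalˡ : ∀ a n j → a * (n C j) + a * (n C suc j) ≡ a * (suc n C suc j)
pascalˡ a n j = trans (sym (*-distribˡ-+ a (n C j) _)) (cong (a *_) (nCk+nC[k+1]≡[n+1]C[k+1] n j))

pascalʳ : ∀ a n j → (n C j) * a + (n C suc j) * a ≡ (suc n C suc j) * a
pascalʳ a n j = trans (sym (*-distribʳ-+ a (n C j) _)) (cong (_* a) (nCk+nC[k+1]≡[n+1]C[k+1] n j))

C-zero-suc : ∀ a k → (a C suc k) * (0 C suc k) ≡ 0
C-zero-suc a k = *-zeroʳ (a C suc k)

length-downPaths : ∀ m h k →
  length (downPaths m h k false) ≡ ((h + ⌈ m /2⌉) C k) * (⌊ m /2⌋ C k)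
length-downPaths m h k = trans (length-map (D ∷_) (paths m h k false)) (length-paths m h k)

length-paths-afterUp-zero zero h = refl
length-paths-afterUp-zero (suc zero) h = refl
length-paths-afterUp-zero (suc (suc m)) h = begin
  length (ups (paths m (suc (suc h)) 0 true) ++ downPaths (suc (suc m)) h 0 true)
    ≡⟨ length-++ (ups (paths m (suc (suc h)) 0 true)) ⟩
  length (ups (paths m (suc (suc h)) 0 true)) + 0
    ≡⟨ cong (_+ 0) (length-map (U ∷_) (paths m (suc (suc h)) 0 true)) ⟩
  length (paths m (suc (suc h)) 0 true) + 0
    ≡⟨ cong (_+ 0) (length-paths-afterUp-zero m (suc h)) ⟩
  0 ∎
  where open ≡-Reasoning

length-paths zero zero zero = refl
length-paths zero zero (suc k) = refl
length-paths (suc zero) zero zero = refl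
length-paths (suc zero) zero (suc k) =
  trans (length-map (F ∷_) (paths 0 0 (suc k) false)) (sym (C-zero-suc 1 k))
length-paths (suc (suc m)) zero k = begin
  length (flats (paths (suc m) 0 k false) ++ ups (paths m 1 k true))
    ≡⟨ length-++ (flats (paths (suc m) 0 k false)) ⟩
  length (flats (paths (suc m) 0 k false)) + length (ups (paths m 1 k true))
    ≡⟨ cong₂ _+_ (length-map (F ∷_) (paths (suc m) 0 k false))
                 (length-map (U ∷_) (paths m 1 k true)) ⟩
  length (paths (suc m) 0 k false) + length (paths m 1 k true)
    ≡⟨ cong (_+ length (paths m 1 k true)) (length-paths (suc m) 0 k) ⟩
  (suc Q C k) * (P C k) + length (paths m 1 k true)
    ≡⟨ split k ⟩
  (suc P C k) * (suc Q C k) ∎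
  where
  open ≡-Reasoning
  P = ⌈ m /2⌉
  Q = ⌊ m /2⌋
  split : ∀ k → (suc Q C k) * (P C k) + length (paths m 1 k true) ≡ (suc P C k) * (suc Q C k)
  split zero rewrite length-paths-afterUp-zero m 0 = refl
  split (suc j) rewrite length-paths-afterUp m 0 j =
    trans (+-comm ((suc Q C suc j) * (P C suc j)) _)
          (trans (pascalˡ (suc Q C suc j) P j) (*-comm (suc Q C suc j) _))
length-paths zero (suc h) zero = length-downPaths 0 h 0
length-paths zero (suc h) (suc k) =
  trans (length-downPaths 0 h (suc k)) (trans (C-zero-suc (h + 0) k) (sym (C-zero-suc (suc h + 0) k)))
length-paths (suc zero) (suc h) zero = length-downPaths 1 h 0
length-paths (suc zero) (suc h) (suc k) =
  trans (length-downPaths 1 h (suc k)) (trans (C-zero-suc (h + 1) k) (sym (C-zero-suc (suc h + 1) k)))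
length-paths (suc (suc m)) (suc h) k = begin
  length (ups (paths m (suc (suc h)) k true) ++ downPaths (suc (suc m)) h k false)
    ≡⟨ length-++ (ups (paths m (suc (suc h)) k true)) ⟩
  length (ups (paths m (suc (suc h)) k true)) + length (downPaths (suc (suc m)) h k false)
    ≡⟨ cong₂ _+_ (length-map (U ∷_) (paths m (suc (suc h)) k true))
                 (length-downPaths (suc (suc m)) h k) ⟩
  length (paths m (suc (suc h)) k true) + ((h + suc P) C k) * (suc Q C k)
    ≡⟨ split k ⟩
  ((suc h + suc P) C k) * (suc Q C k) ∎
  where
  open ≡-Reasoning
  P = ⌈ m /2⌉
  Q = ⌊ m /2⌋
  split : ∀ k → length (paths m (suc (suc h)) k true) + ((h + suc P) C k) * (suc Q C k)
              ≡ ((suc h + suc P) C k) * (suc Q C k)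
  split zero rewrite length-paths-afterUp-zero m (suc h) = refl
  split (suc j) rewrite length-paths-afterUp m (suc h) j | +-suc h P =
    trans (cong (_+ (suc (h + P) C suc j) * (suc Q C suc j)) (*-comm (suc Q C suc j) _))
          (pascalʳ (suc Q C suc j) (suc (h + P)) j)

length-paths-afterUp zero h k =
  trans (length-map (D ∷_) (paths 0 h k false)) (trans (length-paths 0 h k) (floor-zero k))
  where
  floor-zero : ∀ k → ((h + 0) C k) * (0 C k) ≡ (1 C suc k) * ((h + 0) C k)
  floor-zero zero = refl
  floor-zero (suc k) = C-zero-suc (h + 0) k
length-paths-afterUp (suc zero) h k =
  trans (length-map (D ∷_) (paths 1 h k false)) (trans (length-paths 1 h k) (floor-zero k))
  where
  floor-zero : ∀ k → ((h + 1) C k) * (0 C k) ≡ (1 C suc k) * ((h + 1) C k)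
  floor-zero zero = refl
  floor-zero (suc k) = C-zero-suc (h + 1) k
length-paths-afterUp (suc (suc m)) h k = begin
  length (ups (paths m (suc (suc h)) (suc k) true) ++ downs (paths (suc (suc m)) h k false))
    ≡⟨ length-++ (ups (paths m (suc (suc h)) (suc k) true)) ⟩
  length (ups (paths m (suc (suc h)) (suc k) true)) + length (downs (paths (suc (suc m)) h k false))
    ≡⟨ cong₂ _+_ (length-map (U ∷_) (paths m (suc (suc h)) (suc k) true))
                 (length-downPaths (suc (suc m)) h k) ⟩
  length (paths m (suc (suc h)) (suc k) true) + (R C k) * (suc Q C k)
    ≡⟨ cong (_+ (R C k) * (suc Q C k)) (length-paths-afterUp m (suc h) k) ⟩
  (suc Q C suc k) * ((suc h + P) C k) + (R C k) * (suc Q C k)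
    ≡⟨ cong (λ x → (suc Q C suc k) * (x C k) + (R C k) * (suc Q C k)) (+-suc h P) ⟨
  (suc Q C suc k) * (R C k) + (R C k) * (suc Q C k)
    ≡⟨ cong (_+ (R C k) * (suc Q C k)) (*-comm (suc Q C suc k) _) ⟩
  (R C k) * (suc Q C suc k) + (R C k) * (suc Q C k)
    ≡⟨ +-comm ((R C k) * (suc Q C suc k)) _ ⟩
  (R C k) * (suc Q C k) + (R C k) * (suc Q C suc k)
    ≡⟨ pascalˡ (R C k) (suc Q) k ⟩
  (R C k) * (suc (suc Q) C suc k)
    ≡⟨ *-comm (R C k) _ ⟩
  (suc (suc Q) C suc k) * (R C k) ∎
  where
  open ≡-Reasoning
  P = ⌈ m /2⌉
  Q = ⌊ m /2⌋
  R = h + suc P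

IsPath : ℕ → ℕ → ℕ → Bool → List Step → Set
IsPath m h k u w = (length w ≡ h + m) × Path h w × (peaks u w ≡ k)

paths-sound     : ∀ m h k u → All (IsPath m h k u) (paths m h k u)
downPaths-sound : ∀ m h k u → All (IsPath m (suc h) k u) (downPaths m h k u)

flats-sound : ∀ m k u → All (IsPath (suc m) 0 k u) (flats (paths m 0 k false))
flats-sound m k u = AllP.map⁺ (All.map (λ (l , p , e) → cong suc l , flat p , e)
                                        (paths-sound m 0 k false))

ups-sound : ∀ m h k u → All (IsPath (suc (suc m)) h k u) (ups (paths m (suc h) k true))
ups-sound m h k u = AllP.map⁺ (All.map (λ (l , p , e) → trans (cong suc l) (sym (shift h m)) , up p , e)
                                        (paths-sound m (suc h) k true))
  where
  shift : ∀ h m → h + suc (suc m) ≡ suc (suc h + m)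
  shift h m = trans (+-suc h (suc m)) (cong suc (+-suc h m))

paths-sound zero zero zero u = (refl , done , refl) ∷ []
paths-sound zero zero (suc k) u = []
paths-sound (suc zero) zero k u = flats-sound 0 k u
paths-sound (suc (suc m)) zero k u = AllP.++⁺ (flats-sound (suc m) k u) (ups-sound m 0 k u)
paths-sound zero (suc h) k u = downPaths-sound zero h k u
paths-sound (suc zero) (suc h) k u = downPaths-sound (suc zero) h k u
paths-sound (suc (suc m)) (suc h) k u =
  AllP.++⁺ (ups-sound m (suc h) k u) (downPaths-sound (suc (suc m)) h k u)
downPaths-sound m h k false = AllP.map⁺ (All.map (λ (l , p , e) → cong suc l , down p , e)
                                                  (paths-sound m h k false))
downPaths-sound m h zero true = []
downPaths-sound m h (suc k) true = AllP.map⁺ (All.map (λ (l , p , e) → cong suc l , down p , cong suc e)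
                                                       (paths-sound m h k false))

Distinct : List (List Step) → Set
Distinct = AllPairs (λ v w → v ≢ w)

prefix-distinct : ∀ s ws → Distinct ws → Distinct (map (s ∷_) ws)
prefix-distinct s ws d = APP.map⁺ (AP.map (λ v≢w eq → v≢w (∷-injectiveʳ eq)) d)

prefixes-distinct : ∀ s t → s ≢ t → ∀ vs ws → Distinct vs → Distinct ws →
  Distinct (map (s ∷_) vs ++ map (t ∷_) ws)
prefixes-distinct s t s≢t vs ws dv dw = APP.++⁺ (prefix-distinct s vs dv) (prefix-distinct t ws dw)
  (AllP.map⁺ (All.universal (λ v → AllP.map⁺ (All.universal (λ w eq → s≢t (∷-injectiveˡ eq)) ws)) vs))

map-pairwise : ∀ {A B : Set} {P : A → Set} {R : A → A → Set} {S : B → B → Set} (g : A → B) →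
  (∀ {a b} → P a → P b → R a b → S (g a) (g b)) →
  ∀ {xs} → All P xs → AllPairs R xs → AllPairs S (map g xs)
map-pairwise g h [] [] = []
map-pairwise g h (pa ∷ ps) (ra ∷ rs) =
  AllP.map⁺ (All.zipWith (λ (pb , rab) → h pa pb rab) (ps , ra)) ∷ map-pairwise g h ps rs

paths-distinct     : ∀ m h k u → Distinct (paths m h k u)
afterDown-distinct : ∀ m h k u → Distinct (afterDown m h k u)
paths-distinct zero zero zero u = [] ∷ []
paths-distinct zero zero (suc k) u = []
paths-distinct (suc zero) zero k u = prefix-distinct F _ (paths-distinct 0 0 k false)
paths-distinct (suc (suc m)) zero k u =
  prefixes-distinct F U (λ ()) _ _ (paths-distinct (suc m) 0 k false) (paths-distinct m 1 k true)
paths-distinct zero (suc h) k u = prefix-distinct D _ (afterDown-distinct zero h k u)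
paths-distinct (suc zero) (suc h) k u = prefix-distinct D _ (afterDown-distinct (suc zero) h k u)
paths-distinct (suc (suc m)) (suc h) k u =
  prefixes-distinct U D (λ ()) _ _ (paths-distinct m (suc (suc h)) k true)
                                   (afterDown-distinct (suc (suc m)) h k u)
afterDown-distinct m h k false = paths-distinct m h k false
afterDown-distinct m h zero true = []
afterDown-distinct m h (suc k) true = paths-distinct m h k false

path-length : ∀ {h w} → Path h w → h ≤ length w
path-length done = z≤n
path-length (flat p) = z≤n
path-length (up p) = ≤-trans (n≤1+n _) (≤-trans (path-length p) (n≤1+n _))
path-length (down p) = s≤s (path-length p)

prefix-∈ : ∀ (s : Step) {w : List Step} {ws : List (List Step)} → w ∈ ws → (s ∷ w) ∈ map (s ∷_) ws
prefix-∈ s (here refl) = here refl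
prefix-∈ s (there w∈ws) = there (prefix-∈ s w∈ws)

paths-complete : ∀ m h k u w → IsPath m h k u w → w ∈ paths m h k u
afterDown-complete : ∀ m h k u w → length w ≡ h + m → Path h w →
  bit u + peaks false w ≡ k → w ∈ afterDown m h k u
afterDown-complete m h k false w l p e = paths-complete m h k false w (l , p , e)
afterDown-complete m h zero true w l p ()
afterDown-complete m h (suc k) true w l p e = paths-complete m h k false w (l , p , suc-injective e)

paths-complete zero .0 zero u [] (l , done , e) = here refl
paths-complete zero .0 (suc k) u [] (l , done , ())
paths-complete (suc m) .0 k u [] (() , done , e)
paths-complete zero .0 k u (F ∷ w) (() , flat p , e)
paths-complete (suc zero) .0 k u (F ∷ w) (l , flat p , e) =
  prefix-∈ F (paths-complete 0 0 k false w (suc-injective l , p , e))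
paths-complete (suc (suc m)) .0 k u (F ∷ w) (l , flat p , e) =
  AnyP.++⁺ˡ (prefix-∈ F (paths-complete (suc m) 0 k false w (suc-injective l , p , e)))
paths-complete zero h k u (U ∷ w) (l , up p , e) =
  ⊥-elim (<⇒≱ (path-length p) (≤-trans (n≤1+n _) (≤-reflexive (trans l (+-identityʳ h)))))
paths-complete (suc zero) h k u (U ∷ w) (l , up p , e) =
  ⊥-elim (<⇒≱ (path-length p) (≤-reflexive (suc-injective (trans l (+-comm h 1)))))
paths-complete (suc (suc m)) zero k u (U ∷ w) (l , up p , e) =
  AnyP.++⁺ʳ (flats (paths (suc m) 0 k false))
            (prefix-∈ U (paths-complete m 1 k true w (suc-injective l , p , e)))
paths-complete (suc (suc m)) (suc h) k u (U ∷ w) (l , up p , e) =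
  AnyP.++⁺ˡ (prefix-∈ U (paths-complete m (suc (suc h)) k true w (l′ , p , e)))
  where
  l′ : length w ≡ suc (suc h) + m
  l′ = suc-injective (trans l (cong suc (trans (+-suc h (suc m)) (cong suc (+-suc h m)))))
paths-complete zero (suc h) k u (D ∷ w) (l , down p , e) =
  prefix-∈ D (afterDown-complete zero h k u w (suc-injective l) p e)
paths-complete (suc zero) (suc h) k u (D ∷ w) (l , down p , e) =
  prefix-∈ D (afterDown-complete (suc zero) h k u w (suc-injective l) p e)
paths-complete (suc (suc m)) (suc h) k u (D ∷ w) (l , down p , e) =
  AnyP.++⁺ʳ (ups (paths m (suc (suc h)) k true))
            (prefix-∈ D (afterDown-complete (suc (suc m)) h k u w (suc-injective l) p e))

count : (ℕ → Bool) → ℕ → ℕ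
count p zero    = 0
count p (suc n) = bit (p 0) + count (λ i → p (suc i)) n

count-suc : ∀ p n → count p (suc n) ≡ count p n + bit (p n)
count-suc p zero = +-comm (bit (p 0)) 0
count-suc p (suc n) = trans (cong (bit (p 0) +_) (count-suc (λ i → p (suc i)) n))
                            (sym (+-assoc (bit (p 0)) _ _))

count-cong : ∀ p q n → (∀ i → i < n → p i ≡ q i) → count p n ≡ count q n
count-cong p q zero e = refl
count-cong p q (suc n) e = cong₂ _+_ (cong bit (e 0 z<s)) (count-cong _ _ n (λ i i<n → e (suc i) (s<s i<n)))

count-mono : ∀ p {m n} → m ≤ n → count p m ≤ count p n
count-mono p {m} {n} m≤n with ≤⇒≤′ m≤n
... | ≤′-refl = ≤-refl
... | ≤′-step {n = n′} m≤n′ = ≤-trans (count-mono p (≤′⇒≤ m≤n′))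
                                      (≤-trans (m≤m+n _ _) (≤-reflexive (sym (count-suc p n′))))

count-hit : ∀ p i → p i ≡ true → count p (suc i) ≡ suc (count p i)
count-hit p i e = trans (count-suc p i) (trans (cong (λ b → count p i + bit b) e) (+-comm (count p i) 1))

count-strict : ∀ p {i j} → p i ≡ true → i < j → count p i < count p j
count-strict p {i} {j} e i<j = subst (_≤ count p j) (count-hit p i e) (count-mono p i<j)

count-remove : ∀ q y m → y < m → q y ≡ true → count (λ z → q z ∧ not (z ≡ᵇ y)) m + 1 ≡ count q m
count-remove q zero (suc m) _ qy = begin
  bit (q 0 ∧ false) + count (λ z → q (suc z) ∧ true) m + 1
    ≡⟨ cong (λ b → bit b + count (λ z → q (suc z) ∧ true) m + 1) (∧-zeroʳ (q 0)) ⟩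
  count (λ z → q (suc z) ∧ true) m + 1
    ≡⟨ cong (_+ 1) (count-cong _ _ m (λ j _ → ∧-identityʳ (q (suc j)))) ⟩
  count (λ z → q (suc z)) m + 1
    ≡⟨ +-comm _ 1 ⟩
  1 + count (λ z → q (suc z)) m
    ≡⟨ cong (λ b → bit b + count (λ z → q (suc z)) m) qy ⟨
  count q (suc m) ∎
  where open ≡-Reasoning
count-remove q (suc y) (suc m) (s<s y<m) qy = begin
  bit (q 0 ∧ true) + count (λ z → q (suc z) ∧ not (z ≡ᵇ y)) m + 1
    ≡⟨ cong (λ b → bit b + count (λ z → q (suc z) ∧ not (z ≡ᵇ y)) m + 1) (∧-identityʳ (q 0)) ⟩
  bit (q 0) + count (λ z → q (suc z) ∧ not (z ≡ᵇ y)) m + 1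
    ≡⟨ +-assoc (bit (q 0)) _ 1 ⟩
  bit (q 0) + (count (λ z → q (suc z) ∧ not (z ≡ᵇ y)) m + 1)
    ≡⟨ cong (bit (q 0) +_) (count-remove (λ z → q (suc z)) y m y<m qy) ⟩
  count q (suc m) ∎
  where open ≡-Reasoning

count-injection : ∀ m m′ (p q : ℕ → Bool) (g : ℕ → ℕ) →
  (∀ i → i < m → p i ≡ true → (g i < m′) × (q (g i) ≡ true)) →
  (∀ i i′ → i < m → i′ < m → p i ≡ true → p i′ ≡ true → g i ≡ g i′ → i ≡ i′) →
  count p m ≤ count q m′
count-injection zero m′ p q g maps inj = z≤n
count-injection (suc m) m′ p q g maps inj =
  subst (_≤ count q m′) (sym (count-suc p m)) (last (p m) refl)
  where
  below : ∀ {i} → i < m → i < suc m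
  below i<m = <-trans i<m (n<1+n m)
  inj′ : ∀ i i′ → i < m → i′ < m → p i ≡ true → p i′ ≡ true → g i ≡ g i′ → i ≡ i′
  inj′ i i′ i<m i′<m = inj i i′ (below i<m) (below i′<m)
  last : ∀ b → p m ≡ b → count p m + bit b ≤ count q m′
  last false _ = subst (_≤ count q m′) (sym (+-identityʳ _))
    (count-injection m m′ p q g (λ i i<m → maps i (below i<m)) inj′)
  -- the image y of the last hit is removed from q before recursing
  last true pm = subst (count p m + 1 ≤_) (count-remove q y m′ (hit .proj₁) (hit .proj₂))
      (+-monoˡ-≤ 1 (count-injection m m′ p q′ g maps′ inj′))
    where
    hit = maps m (n<1+n m) pm
    y = g m
    q′ : ℕ → Bool
    q′ z = q z ∧ not (z ≡ᵇ y)
    misses-y : ∀ i → i < m → p i ≡ true → (g i ≡ᵇ y) ≡ false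
    misses-y i i<m pi with g i ≡ᵇ y in eq
    ... | false = refl
    ... | true = contradiction
      (inj i m (below i<m) (n<1+n m) pi pm (≡ᵇ⇒≡ (g i) y (Equivalence.from T-≡ eq))) (<⇒≢ i<m)
    maps′ : ∀ i → i < m → p i ≡ true → (g i < m′) × (q′ (g i) ≡ true)
    maps′ i i<m pi = maps i (below i<m) pi .proj₁ ,
      cong₂ _∧_ (maps i (below i<m) pi .proj₂) (cong not (misses-y i i<m pi))

-- The j-th step of a word (F past its end; only positions j < length w matter).
at : List Step → ℕ → Step
at []      j       = F
at (s ∷ w) zero    = s
at (s ∷ w) (suc j) = at w j

_==_ : Step → Step → Bool
U == U = true
D == D = true
F == F = true
_ == _ = false

==⇒≡ : ∀ {s t} → s == t ≡ true → s ≡ t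
==⇒≡ {U} {U} _ = refl
==⇒≡ {D} {D} _ = refl
==⇒≡ {F} {F} _ = refl
==⇒≡ {U} {D} ()
==⇒≡ {U} {F} ()
==⇒≡ {D} {U} ()
==⇒≡ {D} {F} ()
==⇒≡ {F} {U} ()
==⇒≡ {F} {D} ()

≡⇒== : ∀ {s t} → s ≡ t → s == t ≡ true
≡⇒== {U} refl = refl
≡⇒== {D} refl = refl
≡⇒== {F} refl = refl

occ : Step → List Step → ℕ → ℕ
occ s w = count (λ j → at w j == s)

total : Step → List Step → ℕ
total s w = occ s w (length w)

-- `nth s w r`: the position of the r-th (from 0) occurrence of s in w.
nth : Step → List Step → ℕ → ℕ
nth s []      r = 0
nth s (t ∷ w) r = next (t == s) r
  where
  next : Bool → ℕ → ℕ
  next true  zero    = 0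
  next true  (suc r) = suc (nth s w r)
  next false r       = suc (nth s w r)

nth-occ : ∀ s w j → at w j ≡ s → j < length w → nth s w (occ s w j) ≡ j
nth-occ s (t ∷ w) zero e _ rewrite e | ≡⇒== {s} refl = refl
nth-occ s (t ∷ w) (suc j) e (s<s j<n) with t == s
... | true  = cong suc (nth-occ s w j e j<n)
... | false = cong suc (nth-occ s w j e j<n)

occ-nth : ∀ s w r → r < total s w →
  (nth s w r < length w) × (at w (nth s w r) ≡ s) × (occ s w (nth s w r) ≡ r)
occ-nth s (t ∷ w) r r<tot with t == s in eq
occ-nth s (t ∷ w) zero r<tot | true = z<s , ==⇒≡ eq , refl
occ-nth s (t ∷ w) (suc r) (s<s r<tot) | true with occ-nth s w r r<tot
... | lt , at≡ , occ≡ = s<s lt , at≡ , trans (cong (λ b → bit b + occ s w (nth s w r)) eq) (cong suc occ≡)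
occ-nth s (t ∷ w) r r<tot | false with occ-nth s w r r<tot
... | lt , at≡ , occ≡ = s<s lt , at≡ , trans (cong (λ b → bit b + occ s w (nth s w r)) eq) occ≡

nth-mono : ∀ s w r r′ → r < r′ → r′ < total s w → nth s w r < nth s w r′
nth-mono s w r r′ r<r′ r′<tot with occ-nth s w r (<-trans r<r′ r′<tot) | occ-nth s w r′ r′<tot
... | _ , _ , occ-r | _ , _ , occ-r′ with <-cmp (nth s w r) (nth s w r′)
...   | tri< lt _ _ = lt
...   | tri≈ _ eq _ = contradiction (trans (sym occ-r) (trans (cong (occ s w) eq) occ-r′)) (<⇒≢ r<r′)
...   | tri> _ _ gt = contradiction (subst₂ _≤_ occ-r′ occ-r (count-mono _ (<⇒≤ gt))) (<⇒≱ r<r′)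

path-prefix-balance : ∀ {h w} → Path h w → ∀ j → j ≤ length w → occ D w j ≤ h + occ U w j
path-prefix-balance p zero _ = z≤n
path-prefix-balance (flat p) (suc j) (s≤s j≤n) = path-prefix-balance p j j≤n
path-prefix-balance {h} (up {w = w} p) (suc j) (s≤s j≤n) =
  subst (occ D w j ≤_) (sym (+-suc h (occ U w j))) (path-prefix-balance p j j≤n)
path-prefix-balance (down p) (suc j) (s≤s j≤n) = s≤s (path-prefix-balance p j j≤n)

path-total-balance : ∀ {h w} → Path h w → total D w ≡ h + total U w
path-total-balance done = refl
path-total-balance (flat p) = path-total-balance p
path-total-balance {h} (up {w = w} p) = trans (path-total-balance p) (sym (+-suc h (total U w)))
path-total-balance (down p) = cong suc (path-total-balance p)

path-flat-balance : ∀ {h w} → Path h w → ∀ j → j < length w → at w j ≡ F → occ D w j ≡ h + occ U w j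
path-flat-balance (flat p) zero _ _ = refl
path-flat-balance (flat p) (suc j) (s<s j<n) e = path-flat-balance p j j<n e
path-flat-balance {h} (up {w = w} p) (suc j) (s<s j<n) e =
  trans (path-flat-balance p j j<n e) (sym (+-suc h (occ U w j)))
path-flat-balance (down p) (suc j) (s<s j<n) e = cong suc (path-flat-balance p j j<n e)

path-from-balance : ∀ h w →
  (∀ j → j ≤ length w → occ D w j ≤ h + occ U w j) →
  total D w ≡ h + total U w →
  (∀ j → j < length w → at w j ≡ F → occ D w j ≡ h + occ U w j) →
  Path h w
path-from-balance zero [] _ _ _ = done
path-from-balance (suc h) [] _ () _
path-from-balance h (U ∷ w) prefix tot at-flat = up (path-from-balance (suc h) w
  (λ j j≤n → subst (occ D w j ≤_) (+-suc h (occ U w j)) (prefix (suc j) (s≤s j≤n)))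
  (trans tot (+-suc h (total U w)))
  (λ j j<n e → trans (at-flat (suc j) (s<s j<n) e) (+-suc h (occ U w j))))
path-from-balance zero (D ∷ w) prefix tot at-flat with prefix 1 (s≤s z≤n)
... | ()
path-from-balance (suc h) (D ∷ w) prefix tot at-flat = down (path-from-balance h w
  (λ j j≤n → ≤-pred (prefix (suc j) (s≤s j≤n)))
  (suc-injective tot)
  (λ j j<n e → suc-injective (at-flat (suc j) (s<s j<n) e)))
path-from-balance zero (F ∷ w) prefix tot at-flat = flat (path-from-balance zero w
  (λ j j≤n → prefix (suc j) (s≤s j≤n))
  tot
  (λ j j<n e → at-flat (suc j) (s<s j<n) e))
path-from-balance (suc h) (F ∷ w) prefix tot at-flat with at-flat 0 z<s refl
... | ()

-- This decodes a path into an involution.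
partnerOf : Step → List Step → ℕ → ℕ
partnerOf U w j = nth D w (occ U w j)
partnerOf D w j = nth U w (occ D w j)
partnerOf F w j = j

partner : List Step → ℕ → ℕ
partner w j = partnerOf (at w j) w j

module _ {w : List Step} (p : Path 0 w) where

  balanced : total D w ≡ total U w
  balanced = path-total-balance p

  up-rank : ∀ j → j < length w → at w j ≡ U → occ U w j < total D w
  up-rank j j<n e = subst (occ U w j <_) (sym balanced) (count-strict _ (≡⇒== e) j<n)

  -- A down step comes after the up step of the same rank: otherwise the
  -- prefix ending at the down step would contain more D's than U's.
  down-after-up : ∀ u d → d < length w → at w u ≡ U → at w d ≡ D →
    occ D w d ≡ occ U w u → u < d
  down-after-up u d d<n atU atD same with <-cmp u d
  ... | tri< u<d _ _ = u<d
  ... | tri≈ _ u≡d _ = contradiction (trans (sym atU) (trans (cong (at w) u≡d) atD)) λ ()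
  ... | tri> _ _ d<u = ⊥-elim (<-irrefl refl (begin-strict
        occ U w u                <⟨ n<1+n _ ⟩
        suc (occ U w u)          ≡⟨ cong suc same ⟨
        suc (occ D w d)          ≡⟨ count-hit _ d (≡⇒== atD) ⟨
        occ D w (suc d)          ≤⟨ path-prefix-balance p (suc d) d<n ⟩
        occ U w (suc d)          ≤⟨ count-mono _ d<u ⟩
        occ U w u                ∎))
    where open ≤-Reasoning

  rank-partner : ∀ s s′ → total s w ≡ total s′ w → ∀ j → j < length w → at w j ≡ s →
    let t = nth s′ w (occ s w j) in
    (t < length w) × (at w t ≡ s′) × (occ s′ w t ≡ occ s w j)
  rank-partner s s′ tot j j<n atj =
    occ-nth s′ w (occ s w j) (subst (occ s w j <_) tot (count-strict _ (≡⇒== atj) j<n))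

  partner-up : ∀ j → j < length w → at w j ≡ U →
    (partner w j < length w) × (at w (partner w j) ≡ D) ×
    (partner w (partner w j) ≡ j) × (j < partner w j)
  partner-up j j<n atj rewrite atj with rank-partner U D (sym balanced) j j<n atj
  ... | t<n , att , same rewrite att =
    t<n , refl , trans (cong (nth U w) same) (nth-occ U w j atj j<n) ,
    down-after-up j _ t<n atj att same

  partner-down : ∀ j → j < length w → at w j ≡ D →
    (partner w j < length w) × (at w (partner w j) ≡ U) ×
    (partner w (partner w j) ≡ j) × (partner w j < j)
  partner-down j j<n atj rewrite atj with rank-partner D U balanced j j<n atj
  ... | t<n , att , same rewrite att =
    t<n , refl , trans (cong (nth D w) same) (nth-occ D w j atj j<n) ,
    down-after-up _ j j<n att atj (sym same)

  partner-flat : ∀ j → at w j ≡ F → partner w j ≡ j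
  partner-flat j atj = cong (λ s → partnerOf s w j) atj

data Which (s : Step) : Set where
  isU : s ≡ U → Which s
  isD : s ≡ D → Which s
  isF : s ≡ F → Which s

which : ∀ s → Which s
which U = isU refl
which D = isD refl
which F = isF refl

kind : ℕ → ℕ → Step
kind a j with <-cmp j a
... | tri< _ _ _ = U
... | tri≈ _ _ _ = F
... | tri> _ _ _ = D

kind-U : ∀ {a j} → j < a → kind a j ≡ U
kind-U {a} {j} j<a with <-cmp j a
... | tri< _ _ _ = refl
... | tri≈ ¬j<a _ _ = contradiction j<a ¬j<a
... | tri> ¬j<a _ _ = contradiction j<a ¬j<a

kind-F : ∀ {a j} → j ≡ a → kind a j ≡ F
kind-F {a} {j} j≡a with <-cmp j a
... | tri< _ j≢a _ = contradiction j≡a j≢a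
... | tri≈ _ _ _ = refl
... | tri> _ j≢a _ = contradiction j≡a j≢a

kind-D : ∀ {a j} → a < j → kind a j ≡ D
kind-D {a} {j} a<j with <-cmp j a
... | tri< _ _ ¬a<j = contradiction a<j ¬a<j
... | tri≈ _ _ ¬a<j = contradiction a<j ¬a<j
... | tri> _ _ _ = refl

kind-U⁻ : ∀ {a j} → kind a j ≡ U → j < a
kind-U⁻ {a} {j} e with <-cmp j a | e
... | tri< j<a _ _ | _ = j<a
... | tri≈ _ _ _ | ()
... | tri> _ _ _ | ()

kind-F⁻ : ∀ {a j} → kind a j ≡ F → j ≡ a
kind-F⁻ {a} {j} e with <-cmp j a | e
... | tri< _ _ _ | ()
... | tri≈ _ j≡a _ | _ = j≡a
... | tri> _ _ _ | ()

kind-D⁻ : ∀ {a j} → kind a j ≡ D → a < j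
kind-D⁻ {a} {j} e with <-cmp j a | e
... | tri< _ _ _ | ()
... | tri≈ _ _ _ | ()
... | tri> _ _ a<j | _ = a<j

-- These are
-- exactly the 321-avoiding involutions (`avoider-nonnesting`,
-- `NonnestingInvolution.avoids321`).
record NonnestingInvolution (n : ℕ) (f : ℕ → ℕ) : Set where
  field
    bounded    : ∀ j → j < n → f j < n
    involutive : ∀ j → j < n → f (f j) ≡ j
    nonnesting : ∀ i j → i < j → j < n → i < f i → j < f j → f i < f j
    uncovered  : ∀ i j → i < j → j < f i → f i < n → f j ≢ j

module _ {w : List Step} (p : Path 0 w) where
  private n = length w

  partner-kind : ∀ j → j < n → kind (partner w j) j ≡ at w j
  partner-kind j j<n with which (at w j)
  ... | isU e = trans (kind-U (partner-up p j j<n e .proj₂ .proj₂ .proj₂)) (sym e)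
  ... | isD e = trans (kind-D (partner-down p j j<n e .proj₂ .proj₂ .proj₂)) (sym e)
  ... | isF e = trans (kind-F (sym (partner-flat p j e))) (sym e)

  opener-up : ∀ j → j < n → j < partner w j → at w j ≡ U
  opener-up j j<n lt = trans (sym (partner-kind j j<n)) (kind-U lt)

  fixed-flat : ∀ j → j < n → partner w j ≡ j → at w j ≡ F
  fixed-flat j j<n eq = trans (sym (partner-kind j j<n)) (kind-F (sym eq))

  partner-nonnesting : NonnestingInvolution n (partner w)
  partner-nonnesting = record
    { bounded = bounded ; involutive = involutive ; nonnesting = nonnesting ; uncovered = uncovered }
    where
    bounded : ∀ j → j < n → partner w j < n
    bounded j j<n with which (at w j)
    ... | isU e = partner-up p j j<n e .proj₁
    ... | isD e = partner-down p j j<n e .proj₁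
    ... | isF e = subst (_< n) (sym (partner-flat p j e)) j<n

    involutive : ∀ j → j < n → partner w (partner w j) ≡ j
    involutive j j<n with which (at w j)
    ... | isU e = partner-up p j j<n e .proj₂ .proj₂ .proj₁
    ... | isD e = partner-down p j j<n e .proj₂ .proj₂ .proj₁
    ... | isF e = trans (cong (partner w) (partner-flat p j e)) (partner-flat p j e)

    -- Openers i < j have ranks occ U i < occ U j, hence ordered partners.
    nonnesting : ∀ i j → i < j → j < n → i < partner w i → j < partner w j → partner w i < partner w j
    nonnesting i j i<j j<n i< j< =
      subst₂ _<_ (cong (λ s → partnerOf s w i) (sym ei)) (cong (λ s → partnerOf s w j) (sym ej))
        (nth-mono D w _ _ (count-strict _ (≡⇒== ei) i<j) (up-rank p j j<n ej))
      where
      ei = opener-up i (<-trans i<j j<n) i<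
      ej = opener-up j j<n j<

    -- A flat step j under the arc (i, partner i) would see more U's than
    -- D's before it.
    uncovered : ∀ i j → i < j → j < partner w i → partner w i < n → partner w j ≢ j
    uncovered i j i<j j<t t<n fixed = <-irrefl (path-flat-balance p j j<n (fixed-flat j j<n fixed)) (begin-strict
        occ D w j                       ≤⟨ count-mono _ (<⇒≤ j<t) ⟩
        occ D w (partner w i)           ≡⟨ cong (occ D w) (cong (λ s → partnerOf s w i) ei) ⟩
        occ D w (nth D w (occ U w i))   ≡⟨ occ-nth D w (occ U w i) (up-rank p i i<n ei) .proj₂ .proj₂ ⟩
        occ U w i                       <⟨ count-strict _ (≡⇒== ei) i<j ⟩
        occ U w j                       ∎)
      where
      open ≤-Reasoning
      j<n = <-trans j<t t<n
      i<n = <-trans i<j j<n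
      ei = opener-up i i<n (<-trans i<j j<t)

involution-injective : ∀ {n} {f : ℕ → ℕ} → (∀ j → j < n → f (f j) ≡ j) →
  ∀ {i j} → i < n → j < n → f i ≡ f j → i ≡ j
involution-injective {f = f} involutive {i} {j} i<n j<n eq =
  trans (sym (involutive i i<n)) (trans (cong f eq) (involutive j j<n))

Avoids321ℕ : ℕ → (ℕ → ℕ) → Set
Avoids321ℕ n f = ∀ i j k → i < j → j < k → k < n → ¬ ((f j < f i) × (f k < f j))

-- A 321-avoiding involution is nonnesting: a nested or a fixed point under
-- an arc (i, f i) produces a 321 pattern together with i and f i.
avoider-nonnesting : ∀ n f → (∀ j → j < n → f j < n) → (∀ j → j < n → f (f j) ≡ j) →
  Avoids321ℕ n f → NonnestingInvolution n f
avoider-nonnesting n f bounded involutive avoids = record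
  { bounded = bounded ; involutive = involutive ; nonnesting = nonnesting ; uncovered = uncovered }
  where
  nonnesting : ∀ i j → i < j → j < n → i < f i → j < f j → f i < f j
  nonnesting i j i<j j<n _ j< with <-cmp (f i) (f j)
  ... | tri< lt _ _ = lt
  ... | tri≈ _ eq _ = contradiction (involution-injective involutive (<-trans i<j j<n) j<n eq) (<⇒≢ i<j)
  ... | tri> _ _ gt = ⊥-elim (avoids i j (f j) i<j j< (bounded j j<n)
                                     (gt , subst (_< f j) (sym (involutive j j<n)) j<))
  uncovered : ∀ i j → i < j → j < f i → f i < n → f j ≢ j
  uncovered i j i<j j<fi fi<n fixed = avoids i j (f i) i<j j<fi fi<n
    (subst (_< f i) (sym fixed) j<fi ,
     subst₂ _<_ (sym (involutive i (<-trans i<j (<-trans j<fi fi<n)))) (sym fixed) i<j)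

module NonnestingProperties {n : ℕ} {f : ℕ → ℕ} (N : NonnestingInvolution n f) where
  open NonnestingInvolution N

  closers-ordered : ∀ i j → i < j → j < n → f i < i → f j < j → f i < f j
  closers-ordered i j i<j j<n fi< fj< with <-cmp (f i) (f j)
  ... | tri< lt _ _ = lt
  ... | tri≈ _ eq _ = contradiction (involution-injective involutive (<-trans i<j j<n) j<n eq) (<⇒≢ i<j)
  ... | tri> _ _ gt = contradiction (subst₂ _<_ (involutive j j<n) (involutive i i<n)
           (nonnesting (f j) (f i) gt (bounded i i<n)
              (subst (f j <_) (sym (involutive j j<n)) fj<) (subst (f i <_) (sym (involutive i i<n)) fi<)))
           (<-asym i<j)
    where i<n = <-trans i<j j<n

  -- Nonnesting involutions avoid 321: according to whether the middle
  -- entry j is an opener, a fixed point or a closer, the pattern would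
  -- contradict the order of the openers, the uncovered fixed points, or
  -- the order of the closers.
  avoids321 : Avoids321ℕ n f
  avoids321 i j k i<j j<k k<n (fj<fi , fk<fj) with <-cmp j (f j)
  ... | tri< j< _ _ = opener-middle (<-cmp i (f i))
    where
    j<n = <-trans j<k k<n
    opener-middle : Tri (i < f i) (i ≡ f i) (f i < i) → ⊥
    opener-middle (tri< i< _ _) = <-asym fj<fi (nonnesting i j i<j j<n i< j<)
    opener-middle (tri≈ _ i≡ _) = <-asym fj<fi (<-trans (subst (_< j) i≡ i<j) j<)
    opener-middle (tri> _ _ fi<) = <-asym fj<fi (<-trans fi< (<-trans i<j j<))
  ... | tri≈ _ j≡ _ = uncovered i j i<j (subst (_< f i) (sym j≡) fj<fi)
                                (bounded i (<-trans i<j (<-trans j<k k<n))) (sym j≡)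
  ... | tri> _ _ fj< = <-asym fk<fj (closers-ordered j k j<k k<n fj< (<-trans fk<fj (<-trans fj< j<k)))

  descent⇒opener-closer : ∀ j → suc j < n → f (suc j) < f j → (j < f j) × (f (suc j) < suc j)
  descent⇒opener-closer j sj<n desc = opener , closer
    where
    j<n = <-trans (n<1+n j) sj<n
    opener : j < f j
    opener with <-cmp j (f j)
    ... | tri< lt _ _ = lt
    ... | tri≈ _ j≡ _ = contradiction (sym j≡) (uncovered (f (suc j)) j (subst (f (suc j) <_) (sym j≡) desc)
            (subst (j <_) (sym (involutive (suc j) sj<n)) (n<1+n j))
            (subst (_< n) (sym (involutive (suc j) sj<n)) sj<n))
    ... | tri> _ _ gt = contradiction (closers-ordered j (suc j) (n<1+n j) sj<n gt
                                        (<-trans desc (<-trans gt (n<1+n j)))) (<-asym desc)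
    closer : f (suc j) < suc j
    closer with <-cmp (f (suc j)) (suc j)
    ... | tri< lt _ _ = lt
    ... | tri≈ _ eq _ = contradiction eq (uncovered j (suc j) (n<1+n j) (subst (_< f j) eq desc) (bounded j j<n))
    ... | tri> _ _ gt = contradiction (nonnesting j (suc j) (n<1+n j) sj<n opener gt) (<-asym desc)

  opener-closer⇒descent : ∀ j → j < f j → f (suc j) < suc j → f (suc j) < f j
  opener-closer⇒descent j j< closer = ≤-<-trans (≤-pred closer) j<

-- If j opens an arc in both f and g, which have the same kinds and agree
-- before j, then not f j < g j: the closer b = f j of f is also a closer of
-- g, and its g-partner e = g b < b can be neither before j (f would map it
-- to b as well), nor j (then g j = b), nor after j (the arcs of g at j and
-- e would nest).
opener-not-earlier : ∀ {n f g} → NonnestingInvolution n f → NonnestingInvolution n g →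
  (∀ j → j < n → kind (f j) j ≡ kind (g j) j) →
  ∀ j → j < n → (∀ i → i < j → f i ≡ g i) → j < f j → j < g j → ¬ (f j < g j)
opener-not-earlier {n} {f} {g} Nf Ng same j j<n agree j<fj j<gj fj<gj = position-of-e (<-cmp e j)
  where
  module F = NonnestingInvolution Nf
  module G = NonnestingInvolution Ng
  b = f j
  b<n = F.bounded j j<n
  fb≡j : f b ≡ j
  fb≡j = F.involutive j j<n
  e = g b
  e<b : e < b
  e<b = kind-D⁻ (trans (sym (same b b<n)) (kind-D (subst (_< b) (sym fb≡j) j<fj)))
  ge≡b : g e ≡ b
  ge≡b = G.involutive b b<n
  e<n = <-trans e<b b<n
  position-of-e : Tri (e < j) (e ≡ j) (j < e) → ⊥
  position-of-e (tri< e<j _ _) =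
    <-irrefl (involution-injective {f = f} F.involutive e<n j<n (trans (agree e e<j) ge≡b)) e<j
  position-of-e (tri≈ _ e≡j _) = <-irrefl (trans (sym ge≡b) (cong g e≡j)) fj<gj
  position-of-e (tri> _ _ j<e) = <-asym fj<gj
    (subst (g j <_) ge≡b (G.nonnesting j e j<e e<n j<gj (subst (e <_) (sym ge≡b) e<b)))

-- A nonnesting involution is determined by its sequence of kinds: by
-- complete induction, position j is fixed, closes the arc of an earlier
-- opener, or opens an arc whose end is pinned down by `opener-not-earlier`.
kinds-determine : ∀ {n f g} → NonnestingInvolution n f → NonnestingInvolution n g →
  (∀ j → j < n → kind (f j) j ≡ kind (g j) j) → ∀ j → j < n → f j ≡ g j
kinds-determine {n} {f} {g} Nf Ng same = <-rec (λ j → j < n → f j ≡ g j) step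
  where
  module F = NonnestingInvolution Nf
  module G = NonnestingInvolution Ng
  step : ∀ j → (∀ {i} → i < j → i < n → f i ≡ g i) → j < n → f j ≡ g j
  step j ih j<n with <-cmp j (f j)
  ... | tri≈ _ j≡fj _ = trans (sym j≡fj) (kind-F⁻ (trans (sym (same j j<n)) (kind-F j≡fj)))
  ... | tri> _ _ fj<j = sym (trans (cong g (sym g-fj≡j)) (G.involutive (f j) (F.bounded j j<n)))
    where
    g-fj≡j : g (f j) ≡ j
    g-fj≡j = trans (sym (ih fj<j (<-trans fj<j j<n))) (F.involutive j j<n)
  ... | tri< j<fj _ _ = opener (<-cmp (f j) (g j))
    where
    j<gj : j < g j
    j<gj = kind-U⁻ (trans (sym (same j j<n)) (kind-U j<fj))
    agree : ∀ i → i < j → f i ≡ g i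
    agree i i<j = ih i<j (<-trans i<j j<n)
    opener : Tri (f j < g j) (f j ≡ g j) (g j < f j) → f j ≡ g j
    opener (tri≈ _ eq _) = eq
    opener (tri< lt _ _) = contradiction lt (opener-not-earlier Nf Ng same j j<n agree j<fj j<gj)
    opener (tri> _ _ gt) = contradiction gt (opener-not-earlier Ng Nf (λ i i<n → sym (same i i<n))
                                               j j<n (λ i i<j → sym (agree i i<j)) j<gj j<fj)

encode : (ℕ → ℕ) → ℕ → List Step
encode f = applyUpTo (λ j → kind (f j) j)

at-applyUpTo : ∀ (h : ℕ → Step) n j → j < n → at (applyUpTo h n) j ≡ h j
at-applyUpTo h (suc n) zero _ = refl
at-applyUpTo h (suc n) (suc j) (s<s j<n) = at-applyUpTo (λ i → h (suc i)) n j j<n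

length-encode : ∀ f n → length (encode f n) ≡ n
length-encode f = length-applyUpTo (λ j → kind (f j) j)

at-encode : ∀ f n j → j < n → at (encode f n) j ≡ kind (f j) j
at-encode f = at-applyUpTo (λ j → kind (f j) j)

ofKind : (ℕ → ℕ) → Step → ℕ → Bool
ofKind f s i = kind (f i) i == s

occ-encode : ∀ f n s j → j ≤ n → occ s (encode f n) j ≡ count (ofKind f s) j
occ-encode f n s j j≤n =
  count-cong _ _ j (λ i i<j → cong (_== s) (at-encode f n i (<-≤-trans i<j j≤n)))

module Encoding {n : ℕ} {f : ℕ → ℕ} (N : NonnestingInvolution n f) where
  open NonnestingInvolution N

  -- In every prefix there are at most as many closers as openers, since f
  -- maps closers injectively to earlier openers.
  closers≤openers : ∀ j → j ≤ n → count (ofKind f D) j ≤ count (ofKind f U) j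
  closers≤openers j j≤n = count-injection j j (ofKind f D) (ofKind f U) f
    (λ i i<j closer → let fi<i = kind-D⁻ (==⇒≡ closer) in
       <-trans fi<i i<j ,
       ≡⇒== (trans (cong (λ x → kind x (f i)) (involutive i (<-≤-trans i<j j≤n))) (kind-U fi<i)))
    (λ i i′ i<j i′<j _ _ → involution-injective involutive (<-≤-trans i<j j≤n) (<-≤-trans i′<j j≤n))

  openers≤closers : ∀ j → j ≤ n → (∀ i → i < j → i < f i → f i < j) →
    count (ofKind f U) j ≤ count (ofKind f D) j
  openers≤closers j j≤n closed = count-injection j j (ofKind f U) (ofKind f D) f
    (λ i i<j opener → let i<fi = kind-U⁻ (==⇒≡ opener) in
       closed i i<j i<fi ,
       ≡⇒== (trans (cong (λ x → kind x (f i)) (involutive i (<-≤-trans i<j j≤n))) (kind-D i<fi)))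
    (λ i i′ i<j i′<j _ _ → involution-injective involutive (<-≤-trans i<j j≤n) (<-≤-trans i′<j j≤n))

  -- No arc spans a fixed point j, so all arcs opened before j close before j.
  closed-before-fixed : ∀ j → j < n → f j ≡ j → ∀ i → i < j → i < f i → f i < j
  closed-before-fixed j j<n fixed i i<j i<fi with <-cmp (f i) j
  ... | tri< lt _ _ = lt
  ... | tri≈ _ eq _ = contradiction (involution-injective involutive (<-trans i<j j<n) j<n (trans eq (sym fixed)))
                                    (<⇒≢ i<j)
  ... | tri> _ _ gt = contradiction fixed (uncovered i j i<j gt (bounded i (<-trans i<j j<n)))

  encode-path : Path 0 (encode f n)
  encode-path = path-from-balance 0 w prefix tot at-flat
    where
    w = encode f n
    len : length w ≡ n
    len = length-encode f n
    balanced-at : ∀ j → j ≤ n → (∀ i → i < j → i < f i → f i < j) → occ D w j ≡ occ U w j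
    balanced-at j j≤n closed = trans (occ-encode f n D j j≤n)
      (trans (≤-antisym (closers≤openers j j≤n) (openers≤closers j j≤n closed))
             (sym (occ-encode f n U j j≤n)))
    prefix : ∀ j → j ≤ length w → occ D w j ≤ occ U w j
    prefix j j≤len = subst₂ _≤_ (sym (occ-encode f n D j j≤n)) (sym (occ-encode f n U j j≤n))
                            (closers≤openers j j≤n)
      where j≤n = subst (j ≤_) len j≤len
    tot : total D w ≡ total U w
    tot rewrite len = balanced-at n ≤-refl (λ i i<n _ → bounded i i<n)
    at-flat : ∀ j → j < length w → at w j ≡ F → occ D w j ≡ occ U w j
    at-flat j j<len atF = balanced-at j (<⇒≤ j<n) (closed-before-fixed j j<n (sym j≡fj))
      where
      j<n = subst (j <_) len j<len
      j≡fj = kind-F⁻ (trans (sym (at-encode f n j j<n)) atF)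

isPeak : Step → Step → Bool
isPeak U t = t == D
isPeak D t = false
isPeak F t = false

peakAt : List Step → ℕ → Bool
peakAt w j = isPeak (at w j) (at w (suc j))

not-after-up : ∀ s x → bit ((s == D) ∧ false) + x ≡ x
not-after-up s x = cong (λ b → bit b + x) (∧-zeroʳ (s == D))

peaks-count : ∀ u s w → peaks u (s ∷ w) ≡ bit ((s == D) ∧ u) + count (peakAt (s ∷ w)) (length w)
peaks-count u U [] = refl
peaks-count u D [] = refl
peaks-count u F [] = refl
peaks-count u U (t ∷ w) =
  trans (peaks-count true t w) (cong (λ b → bit b + count (peakAt (t ∷ w)) (length w)) (∧-identityʳ (t == D)))
peaks-count u D (t ∷ w) = cong (bit u +_) (trans (peaks-count false t w) (not-after-up t _))
peaks-count u F (t ∷ w) = trans (peaks-count false t w) (not-after-up t _)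

isPeak-UD : ∀ s t → isPeak s t ≡ true → (s ≡ U) × (t ≡ D)
isPeak-UD U t e = refl , ==⇒≡ e

<ᵇ-true : ∀ {a b} → a < b → (a <ᵇ b) ≡ true
<ᵇ-true a<b = Equivalence.to T-≡ (<⇒<ᵇ a<b)

<ᵇ-true⁻ : ∀ {a b} → (a <ᵇ b) ≡ true → a < b
<ᵇ-true⁻ {a} {b} e = <ᵇ⇒< a b (Equivalence.from T-≡ e)

<ᵇ-false : ∀ {a b} → ¬ a < b → (a <ᵇ b) ≡ false
<ᵇ-false {a} {b} a≮b with a <ᵇ b in e
... | false = refl
... | true = contradiction (<ᵇ-true⁻ e) a≮b

peaks-descents : ∀ {m f} → NonnestingInvolution (suc m) f → ∀ w → length w ≡ suc m →
  (∀ j → j < suc m → at w j ≡ kind (f j) j) →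
  peaks false w ≡ count (λ j → f (suc j) <ᵇ f j) m
peaks-descents {m} {f} N (s ∷ v) len kinds = begin
  peaks false (s ∷ v)
    ≡⟨ peaks-count false s v ⟩
  bit ((s == D) ∧ false) + count (peakAt (s ∷ v)) (length v)
    ≡⟨ not-after-up s _ ⟩
  count (peakAt (s ∷ v)) (length v)
    ≡⟨ cong (count (peakAt (s ∷ v))) (suc-injective len) ⟩
  count (peakAt (s ∷ v)) m
    ≡⟨ count-cong _ _ m peak≡descent ⟩
  count (λ j → f (suc j) <ᵇ f j) m ∎
  where
  open ≡-Reasoning
  open NonnestingProperties N
  peak⇔descent : ∀ j → suc j < suc m →
    isPeak (kind (f j) j) (kind (f (suc j)) (suc j)) ≡ (f (suc j) <ᵇ f j)
  peak⇔descent j sj<n = ⇔→≡ {z = true} (mk⇔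
    (λ peak → let (opener , closer) = isPeak-UD _ _ peak in
       <ᵇ-true (opener-closer⇒descent j (kind-U⁻ opener) (kind-D⁻ closer)))
    (λ desc → let (opener , closer) = descent⇒opener-closer j sj<n (<ᵇ-true⁻ desc) in
       cong₂ isPeak (kind-U opener) (kind-D closer)))
  peak≡descent : ∀ j → j < m → peakAt (s ∷ v) j ≡ (f (suc j) <ᵇ f j)
  peak≡descent j j<m = trans (cong₂ isPeak (kinds j (<-trans j<m (n<1+n m))) (kinds (suc j) (s<s j<m)))
                             (peak⇔descent j (s<s j<m))

descents-count : ∀ {m k} (a : Fin (suc m) → Fin k) (g : ℕ → ℕ) → (∀ x → toℕ (a x) ≡ g (toℕ x)) →
  descents′ a ≡ count (λ j → g (suc j) <ᵇ g j) m
descents-count {zero} a g a≗g = refl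
descents-count {suc m} a g a≗g with a (fsuc Fin.zero) Fin.<? a Fin.zero
... | yes desc = cong₂ _+_ (cong bit (sym (<ᵇ-true (subst₂ _<_ (a≗g _) (a≗g _) desc)))) rest
  where rest = descents-count (λ i → a (fsuc i)) (λ j → g (suc j)) (λ x → a≗g (fsuc x))
... | no ¬desc = cong₂ _+_ (cong bit (sym (<ᵇ-false (¬desc ∘ subst₂ _<_ (sym (a≗g _)) (sym (a≗g _)))))) rest
  where rest = descents-count (λ i → a (fsuc i)) (λ j → g (suc j)) (λ x → a≗g (fsuc x))

extend : ∀ {n} → (Fin n → Fin n) → ℕ → ℕ
extend {n} π j with j <? n
... | yes j<n = toℕ (π (fromℕ< j<n))
... | no _    = j

extend-toℕ : ∀ {n} (π : Fin n → Fin n) x → extend π (toℕ x) ≡ toℕ (π x)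
extend-toℕ {n} π x with toℕ x <? n
... | yes x<n = cong (toℕ ∘ π) (fromℕ<-toℕ x x<n)
... | no x≮n  = contradiction (toℕ<n x) x≮n

extend-< : ∀ {n} (π : Fin n → Fin n) j (j<n : j < n) → extend π j ≡ toℕ (π (fromℕ< j<n))
extend-< π j j<n = trans (cong (extend π) (sym (toℕ-fromℕ< j<n))) (extend-toℕ π (fromℕ< j<n))

extend-nonnesting : ∀ {n} (π : Fin n → Fin n) → IsInvolution π → Avoids321 π →
  NonnestingInvolution n (extend π)
extend-nonnesting {n} π involutive avoids =
  avoider-nonnesting n (extend π) bounded involutive′ avoids′
  where
  bounded : ∀ j → j < n → extend π j < n
  bounded j j<n = subst (_< n) (sym (extend-< π j j<n)) (toℕ<n _)
  involutive′ : ∀ j → j < n → extend π (extend π j) ≡ j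
  involutive′ j j<n = begin
    extend π (extend π j)             ≡⟨ cong (extend π) (extend-< π j j<n) ⟩
    extend π (toℕ (π (fromℕ< j<n)))   ≡⟨ extend-toℕ π _ ⟩
    toℕ (π (π (fromℕ< j<n)))          ≡⟨ cong toℕ (involutive _) ⟩
    toℕ (fromℕ< j<n)                  ≡⟨ toℕ-fromℕ< j<n ⟩
    j                                 ∎
    where open ≡-Reasoning
  avoids′ : Avoids321ℕ n (extend π)
  avoids′ i j k i<j j<k k<n (fj<fi , fk<fj) = avoids (fromℕ< i<n) (fromℕ< j<n) (fromℕ< k<n)
      (subst₂ _<_ (sym (toℕ-fromℕ< i<n)) (sym (toℕ-fromℕ< j<n)) i<j)
      (subst₂ _<_ (sym (toℕ-fromℕ< j<n)) (sym (toℕ-fromℕ< k<n)) j<k)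
      (subst₂ _<_ (extend-< π j j<n) (extend-< π i i<n) fj<fi ,
       subst₂ _<_ (extend-< π k k<n) (extend-< π j j<n) fk<fj)
    where
    j<n = <-trans j<k k<n
    i<n = <-trans i<j j<n

-- The map of Fin n decoded from a word by the partner function (the
-- fallback to the identity never applies to paths of length n).
decode : ∀ n → List Step → Fin n → Fin n
decode n w x with partner w (toℕ x) <? n
... | yes p<n = fromℕ< p<n
... | no _    = x

module Decoding {n : ℕ} {w : List Step} (len : length w ≡ n) (p : Path 0 w) where

  nonnesting : NonnestingInvolution n (partner w)
  nonnesting = subst (λ l → NonnestingInvolution l (partner w)) len (partner-nonnesting p)

  decode-toℕ : ∀ x → toℕ (decode n w x) ≡ partner w (toℕ x)
  decode-toℕ x with partner w (toℕ x) <? n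
  ... | yes p<n = toℕ-fromℕ< p<n
  ... | no p≮n = contradiction (NonnestingInvolution.bounded nonnesting (toℕ x) (toℕ<n x)) p≮n

  decode-counted : ∀ {m} → n ≡ suc m → Counted (peaks false w) (decode n w)
  decode-counted {m} refl = involutive , avoids , descents
    where
    involutive : IsInvolution (decode n w)
    involutive x = toℕ-injective (begin
      toℕ (decode n w (decode n w x))   ≡⟨ decode-toℕ _ ⟩
      partner w (toℕ (decode n w x))    ≡⟨ cong (partner w) (decode-toℕ x) ⟩
      partner w (partner w (toℕ x))     ≡⟨ NonnestingInvolution.involutive nonnesting (toℕ x) (toℕ<n x) ⟩
      toℕ x                             ∎)
      where open ≡-Reasoning
    avoids : Avoids321 (decode n w)
    avoids x y z x<y y<z (dy<dx , dz<dy) = NonnestingProperties.avoids321 nonnesting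
      (toℕ x) (toℕ y) (toℕ z) x<y y<z (toℕ<n z)
      (subst₂ _<_ (decode-toℕ y) (decode-toℕ x) dy<dx , subst₂ _<_ (decode-toℕ z) (decode-toℕ y) dz<dy)
    descents : des (decode n w) ≡ peaks false w
    descents = trans (descents-count (decode n w) (partner w) decode-toℕ)
      (sym (peaks-descents nonnesting w len (λ j j<n → sym (partner-kind p j (subst (j <_) (sym len) j<n)))))

at-ext : ∀ v w → length v ≡ length w → (∀ j → j < length v → at v j ≡ at w j) → v ≡ w
at-ext [] [] _ _ = refl
at-ext (s ∷ v) (t ∷ w) len same =
  cong₂ _∷_ (same 0 z<s) (at-ext v w (suc-injective len) (λ j j<n → same (suc j) (s<s j<n)))

same-partners : ∀ {n v w} → length v ≡ n → Path 0 v → length w ≡ n → Path 0 w →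
  decode n v ≗ₚ decode n w → ∀ j → j < n → partner v j ≡ partner w j
same-partners {n} {v} {w} lv pv lw pw same j j<n = begin
  partner v j                 ≡⟨ cong (partner v) (toℕ-fromℕ< j<n) ⟨
  partner v (toℕ x)           ≡⟨ Decoding.decode-toℕ lv pv x ⟨
  toℕ (decode n v x)          ≡⟨ cong toℕ (same x) ⟩
  toℕ (decode n w x)          ≡⟨ Decoding.decode-toℕ lw pw x ⟩
  partner w (toℕ x)           ≡⟨ cong (partner w) (toℕ-fromℕ< j<n) ⟩
  partner w j                 ∎
  where
  open ≡-Reasoning
  x = fromℕ< j<n

-- Distinct paths decode to distinct maps: a path is recovered from its
-- partner function as the word of kinds.
decode-injective : ∀ {n v w} → length v ≡ n → Path 0 v → length w ≡ n → Path 0 w →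
  decode n v ≗ₚ decode n w → v ≡ w
decode-injective {n} {v} {w} lv pv lw pw same = at-ext v w (trans lv (sym lw)) same-steps
  where
  open ≡-Reasoning
  same-steps : ∀ j → j < length v → at v j ≡ at w j
  same-steps j j<lv = begin
    at v j               ≡⟨ partner-kind pv j j<lv ⟨
    kind (partner v j) j ≡⟨ cong (λ a → kind a j) (same-partners lv pv lw pw same j j<n) ⟩
    kind (partner w j) j ≡⟨ partner-kind pw j (subst (j <_) (sym lw) j<n) ⟩
    at w j               ∎
    where j<n = subst (j <_) lv j<lv

encode-complete : ∀ m k (π : Fin (suc m) → Fin (suc m)) → Counted k π →
  IsPath (suc m) 0 k false (encode (extend π) (suc m)) × (π ≗ₚ decode (suc m) (encode (extend π) (suc m)))
encode-complete m k π (involutive , avoids , descents) = (len , p , peaks≡k) , π≗decode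
  where
  n = suc m
  f = extend π
  N = extend-nonnesting π involutive avoids
  w = encode f n
  len : length w ≡ n
  len = length-encode f n
  p : Path 0 w
  p = Encoding.encode-path N
  peaks≡k : peaks false w ≡ k
  peaks≡k = trans (peaks-descents N w len (at-encode f n))
                  (trans (sym (descents-count π f (λ x → sym (extend-toℕ π x)))) descents)
  same-kinds : ∀ j → j < n → kind (f j) j ≡ kind (partner w j) j
  same-kinds j j<n = trans (sym (at-encode f n j j<n)) (sym (partner-kind p j (subst (j <_) (sym len) j<n)))
  π≗decode : π ≗ₚ decode n w
  π≗decode x = toℕ-injective (begin
    toℕ (π x)               ≡⟨ extend-toℕ π x ⟨
    f (toℕ x)               ≡⟨ kinds-determine N (Decoding.nonnesting len p) same-kinds (toℕ x) (toℕ<n x) ⟩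
    partner w (toℕ x)       ≡⟨ Decoding.decode-toℕ len p x ⟨
    toℕ (decode n w x)      ∎)
    where open ≡-Reasoning

theorem3p2 : ∀ (n k : ℕ) → 1 ≤ n → k < n →
    HasCount n (Counted k) ((⌈ n /2⌉ C k) * (⌊ n /2⌋ C k))
theorem3p2 (suc m) k _ _ = map (decode n) listed , size , distinct , counted , complete
  where
  n = suc m
  listed = paths n 0 k false
  size : length (map (decode n) listed) ≡ (⌈ n /2⌉ C k) * (⌊ n /2⌋ C k)
  size = trans (length-map (decode n) listed) (length-paths n 0 k)
  distinct : AllPairs (λ π σ → ¬ (π ≗ₚ σ)) (map (decode n) listed)
  distinct = map-pairwise (decode n)
    (λ (lv , pv , _) (lw , pw , _) v≢w same → v≢w (decode-injective lv pv lw pw same))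
    (paths-sound n 0 k false) (paths-distinct n 0 k false)
  counted : All (Counted k) (map (decode n) listed)
  counted = AllP.map⁺ (All.map (λ { (len , p , refl) → Decoding.decode-counted len p refl })
                               (paths-sound n 0 k false))
  complete : ∀ π → Counted k π → Any (π ≗ₚ_) (map (decode n) listed)
  complete π cπ with encode-complete m k π cπ
  ... | spec , π≗decode = AnyP.map⁺ (Any.map (λ { refl → π≗decode }) (paths-complete n 0 k false _ spec))
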